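{- Let $x,y$ be nonzero complex numbers and let $(a_{0,m})_{m\geq 0}$ be a sequence of complex numbers. Define an infinite matrix $(a_{n,m})_{n,m\geq 0}$ whose first row is the given sequence and whose remaining entries are determined by the recurrence $$a_{n+1,m}=x(m+1)\,a_{n,m+1}+y\,m\,a_{n,m}\qquad (n,m\geq 0).$$ Then: (1) For all $n,m\geq 0$, $$a_{n,m}=\frac{1}{m!}\sum_{k=0}^{n}{n+m \brace k+m}_{m}(k+m)!\,y^{n-k}x^{k}\,a_{0,m+k}.$$ (2) For $s\geq 0$ let $A_s(t)=\sum_{k\geq 0}a_{0,k+s}t^{k}$ (a formal power series) and $B_s(t)=\sum_{n\geq 0}a_{n,s}\frac{t^{n}}{n!}$. Then, as formal power series in $t$, $$B_s(t)=\frac{e^{sty}}{s!}\left(e^{ -ty}\frac{d}{dt}\right)^{s}\left[\left(\frac{e^{ty}-1}{y}\right)^{s}A_s\!\left(\frac{x}{y}\left(e^{ty}-1\right)\right)\right].$$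
   Context: For integers $r\geq 0$, the $r$-Stirling numbers of the second kind ${n \brace k}_{r}$ count the partitions of the set $\{1,\dots,n\}$ into exactly $k$ nonempty disjoint blocks such that the elements $1,\dots,r$ lie in distinct blocks; equivalently ${n\brace k}_r=0$ for $n<r$, ${r\brace k}_r=\delta_{k,r}$, and ${n\brace k}_r=k{n-1\brace k}_r+{n-1\brace k-1}_r$ for $n>r$. For $r=0$ these are the ordinary Stirling numbers of the second kind. The composition $A_s\big(\tfrac{x}{y}(e^{ty}-1)\big)$ is well defined as a formal power series in $t$ since $\tfrac{x}{y}(e^{ty}-1)$ has zero constant term. -}

module Defs where

open import Level using (Level; _⊔_) renaming (suc to lsuc)
open import Algebra.Bundles using (CommutativeRing; Semiring)
open import Data.Nat using (ℕ; zero; suc; _∸_; _<ᵇ_; _≡ᵇ_)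
  renaming (_*_ to _*ℕ_; _+_ to _+ℕ_)
open import Data.Nat.Combinatorics using ()
open import Data.Bool using (if_then_else_)
open import Relation.Nullary using (¬_)
import Algebra.Definitions.RawSemiring as RS

fact : ℕ → ℕ
fact zero    = 1
fact (suc n) = suc n *ℕ fact n

δ : ℕ → ℕ → ℕ
δ k r = if k ≡ᵇ r then 1 else 0

-- rStirling r n k  =  { n brace k }_r, defined by the recurrence of the paper:
--   0 for n < r;  δ_{k,r} for n = r;  k {n-1,k}_r + {n-1,k-1}_r for n > r
-- (with {m, -1}_r = 0).
rStirling : ℕ → ℕ → ℕ → ℕ
rStirling r zero k = if r ≡ᵇ 0 then δ k r else 0
rStirling r (suc n) k =
  if suc n <ᵇ r then 0
  else if suc n ≡ᵇ r then δ k r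
  else k *ℕ rStirling r n k +ℕ below k
  where
  below : ℕ → ℕ
  below zero    = 0
  below (suc j) = rStirling r n j

-- Fields of characteristic zero (the paper works over ℂ).
-- A commutative ring together with an inverse operation which is a
-- genuine inverse on nonzero elements, in which n·1 ≠ 0 for all n ≥ 1.

record CharZeroField (c ℓ : Level) : Set (lsuc (c ⊔ ℓ)) where
  field
    commutativeRing : CommutativeRing c ℓ
  open CommutativeRing commutativeRing public
  open RS (Semiring.rawSemiring semiring) public using (_×_; _^_)
  field
    _⁻¹       : Carrier → Carrier
    inverseʳ  : ∀ x → ¬ (x ≈ 0#) → (x * (x ⁻¹)) ≈ 1#
    charZero  : ∀ n → ¬ ((suc n × 1#) ≈ 0#)

module PowerSeries {c ℓ} (F : CharZeroField c ℓ) where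
  open CharZeroField F

  ofℕ : ℕ → Carrier
  ofℕ n = n × 1#

  sumTo : ℕ → (ℕ → Carrier) → Carrier
  sumTo zero    f = f 0
  sumTo (suc n) f = sumTo n f + f (suc n)

  PS : Set c
  PS = ℕ → Carrier

  _≋_ : PS → PS → Set ℓ
  f ≋ g = ∀ n → f n ≈ g n

  const : Carrier → PS
  const a zero    = a
  const a (suc n) = 0#

  _⊕_ : PS → PS → PS
  (f ⊕ g) n = f n + g n

  _⊖_ : PS → PS → PS
  (f ⊖ g) n = f n - g n

  scale : Carrier → PS → PS
  scale a f n = a * f n

  _⊛_ : PS → PS → PS
  (f ⊛ g) n = sumTo n (λ k → f k * g (n ∸ k))

  powS : PS → ℕ → PS
  powS f zero    = const 1#
  powS f (suc k) = f ⊛ powS f k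

  deriv : PS → PS
  deriv f n = ofℕ (suc n) * f (suc n)

  -- composition A(g) for g with zero constant term:
  -- [t^n] A(g) = Σ_{k=0}^{n} A_k [t^n] g^k
  compose : PS → PS → PS
  compose A g n = sumTo n (λ k → A k * powS g k n)

  expS : Carrier → PS
  expS a n = (a ^ n) * (ofℕ (fact n) ⁻¹)

  iterate : ℕ → (PS → PS) → PS → PS
  iterate zero    φ f = f
  iterate (suc s) φ f = φ (iterate s φ f)

{-# OPTIONS --safe #-}
-- Part (1) is an induction on n: the recurrence expresses the sum for a (n + 1) m through the sums
-- for a n (m + 1) and a n m, and the r-Stirling numbers recombine by
-- {n+1 brace k}_r = {n+1 brace k}_{r+1} + r {n brace k}_r.
--
-- For part (2), both sides, as families of series indexed by s, solve the system
-- f_s' = x (s+1) f_{s+1} + s y f_s with constant terms a_{0,s}, and in characteristic zero such a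
-- system has at most one solution with given constant terms. For the right-hand side put
-- D = e^{-ty} d/dt and w = (e^{ty} - 1)/y. Then D w = 1, so D acts on powers of w as d/dw:
-- D^j (w^j H) has constant term j! H(0), and D^{s+1} w^s = 0. With G_s = w^s A_s(x w), the shift
-- A_s(t) = a_{0,s} + t A_{s+1}(t) gives G_s = x G_{s+1} + a_{0,s} w^s, hence
-- D^{s+1} G_s = x D^{s+1} G_{s+1}, which is what differentiating e^{sty} D^s G_s requires.
module Submission where

open import Defs
open import Level using (Level)
open import Data.Nat using (ℕ; zero; suc; _∸_) renaming (_+_ to _+ℕ_)
open import Data.Product using (_×_)
open import Relation.Nullary using (¬_)

open import Data.Nat using (_≤_; _<_; z≤n; s≤s; NonZero; _<ᵇ_; _≡ᵇ_) renaming (_*_ to _*ℕ_)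
open import Data.Nat.Properties as ℕ using ()
open import Data.Nat.Tactic.RingSolver using (solve-∀)
open import Data.Bool using (true; false)
open import Data.Empty using (⊥-elim)
open import Data.Sum using (inj₁; inj₂)
open import Data.Product using (_,_)
open import Data.Unit using (tt)
open import Relation.Nullary using (yes; no)
open import Relation.Binary.Definitions using (tri<; tri≈; tri>)
open import Relation.Binary.Bundles using (Setoid)
open import Relation.Binary.PropositionalEquality as ≡ using (_≡_; _≢_)
open import Algebra.Bundles using (CommutativeSemiring)
open import Algebra.Structures.Biased using (isCommutativeSemiringˡ; isCommutativeMonoidˡ)
import Algebra.Properties.Monoid.Mult as MonoidMult
import Algebra.Properties.Semiring.Mult as SemiringMult
import Algebra.Properties.Semiring.Exp as SemiringExp
import Algebra.Properties.CommutativeSemigroup as CommSemigroupProperties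
import Algebra.Solver.Ring.NaturalCoefficients.Default as Solver
import Relation.Binary.Reasoning.Setoid as SetoidReasoning

module RStirlingProperties where
  open import Data.Nat using (_+_; _*_)
  open ≡ using (refl; sym; trans; cong; cong₂)

  <ᵇ-true : ∀ {m n} → m < n → (m <ᵇ n) ≡ true
  <ᵇ-true (s≤s z≤n)       = refl
  <ᵇ-true (s≤s (s≤s m<n)) = <ᵇ-true (s≤s m<n)

  <ᵇ-false : ∀ {m n} → n ≤ m → (m <ᵇ n) ≡ false
  <ᵇ-false z≤n       = refl
  <ᵇ-false (s≤s n≤m) = <ᵇ-false n≤m

  ≡ᵇ-refl : ∀ n → (n ≡ᵇ n) ≡ true
  ≡ᵇ-refl zero    = refl
  ≡ᵇ-refl (suc n) = ≡ᵇ-refl n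

  ≡ᵇ-false : ∀ {m n} → m ≢ n → (m ≡ᵇ n) ≡ false
  ≡ᵇ-false {zero}  {zero}  m≢n = ⊥-elim (m≢n refl)
  ≡ᵇ-false {zero}  {suc n} _   = refl
  ≡ᵇ-false {suc m} {zero}  _   = refl
  ≡ᵇ-false {suc m} {suc n} m≢n = ≡ᵇ-false (λ m≡n → m≢n (cong suc m≡n))

  open ≡.≡-Reasoning

  δ-refl : ∀ r → δ r r ≡ 1
  δ-refl r rewrite ≡ᵇ-refl r = refl

  δ-≢ : ∀ {k r} → k ≢ r → δ k r ≡ 0
  δ-≢ k≢r rewrite ≡ᵇ-false k≢r = refl

  *-δ : ∀ k r → k * δ k r ≡ r * δ k r
  *-δ k r with k ℕ.≟ r
  ... | yes refl = refl
  ... | no k≢r rewrite δ-≢ k≢r = trans (ℕ.*-zeroʳ k) (sym (ℕ.*-zeroʳ r))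

  rStirling-< : ∀ r n k → n < r → rStirling r n k ≡ 0
  rStirling-< (suc r) zero    k _   = refl
  rStirling-< r       (suc n) k n<r rewrite <ᵇ-true n<r = refl

  rStirling-diag : ∀ r k → rStirling r r k ≡ δ k r
  rStirling-diag zero    k = refl
  rStirling-diag (suc r) k rewrite <ᵇ-false (ℕ.≤-refl {r}) | ≡ᵇ-refl r = refl

  rStirling-suc-zero : ∀ r n → r ≤ n → rStirling r (suc n) 0 ≡ 0
  rStirling-suc-zero r n r≤n
    rewrite <ᵇ-false (ℕ.m≤n⇒m≤1+n r≤n) | ≡ᵇ-false (ℕ.>⇒≢ (s≤s r≤n)) = refl

  rStirling-suc : ∀ r n k → r ≤ n →
    rStirling r (suc n) (suc k) ≡ suc k * rStirling r n (suc k) + rStirling r n k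
  rStirling-suc r n k r≤n
    rewrite <ᵇ-false (ℕ.m≤n⇒m≤1+n r≤n) | ≡ᵇ-false (ℕ.>⇒≢ (s≤s r≤n)) = refl

  data Position (r : ℕ) : ℕ → Set where
    before   : ∀ {n} → n < r → Position r n
    diagonal : Position r r
    after    : ∀ {n} → r ≤ n → Position r (suc n)

  position : ∀ r n → Position r n
  position r n with ℕ.<-cmp n r
  ... | tri< n<r _    _ = before n<r
  ... | tri≈ _ refl _   = diagonal
  position r (suc n) | tri> _ _ (s≤s r≤n) = after r≤n

  rStirling-below : ∀ r n k → k < r → rStirling r n k ≡ 0
  rStirling-below r n k k<r with position r n
  ... | before n<r = rStirling-< r n k n<r
  ... | diagonal   = trans (rStirling-diag r k) (δ-≢ (ℕ.<⇒≢ k<r))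
  rStirling-below r (suc n) zero    k<r | after r≤n = rStirling-suc-zero r n r≤n
  rStirling-below r (suc n) (suc j) k<r | after r≤n = begin
    rStirling r (suc n) (suc j)                            ≡⟨ rStirling-suc r n j r≤n ⟩
    suc j * rStirling r n (suc j) + rStirling r n j
      ≡⟨ cong₂ _+_ (cong (suc j *_) (rStirling-below r n (suc j) k<r))
                   (rStirling-below r n j (ℕ.<-trans (ℕ.n<1+n j) k<r)) ⟩
    suc j * 0 + 0                                          ≡⟨ cong (_+ 0) (ℕ.*-zeroʳ (suc j)) ⟩
    0                                                      ∎

  rStirling-above : ∀ r n k → n < k → rStirling r n k ≡ 0
  rStirling-above r n k n<k with position r n
  ... | before n<r = rStirling-< r n k n<r
  ... | diagonal   = trans (rStirling-diag r k) (δ-≢ (ℕ.>⇒≢ n<k))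
  rStirling-above r (suc n) (suc j) (s≤s n<j) | after r≤n = begin
    rStirling r (suc n) (suc j)                            ≡⟨ rStirling-suc r n j r≤n ⟩
    suc j * rStirling r n (suc j) + rStirling r n j
      ≡⟨ cong₂ _+_ (cong (suc j *_) (rStirling-above r n (suc j) (ℕ.m≤n⇒m≤1+n n<j)))
                   (rStirling-above r n j n<j) ⟩
    suc j * 0 + 0                                          ≡⟨ cong (_+ 0) (ℕ.*-zeroʳ (suc j)) ⟩
    0                                                      ∎

  rStirling-raise : ∀ r n k → r ≤ n →
    rStirling r (suc n) k ≡ rStirling (suc r) (suc n) k + r * rStirling r n k
  rStirling-raise r n k r≤n with position r n
  ... | before n<r = ⊥-elim (ℕ.<⇒≱ n<r r≤n)
  rStirling-raise r r zero    _ | diagonal = begin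
    rStirling r (suc r) 0
      ≡⟨ rStirling-suc-zero r r ℕ.≤-refl ⟩
    0
      ≡⟨ *-δ 0 r ⟩
    r * δ 0 r
      ≡⟨ cong₂ (λ u v → u + r * v) (rStirling-diag (suc r) 0) (rStirling-diag r 0) ⟨
    rStirling (suc r) (suc r) 0 + r * rStirling r r 0 ∎
  rStirling-raise r r (suc j) _ | diagonal = begin
    rStirling r (suc r) (suc j)
      ≡⟨ rStirling-suc r r j ℕ.≤-refl ⟩
    suc j * rStirling r r (suc j) + rStirling r r j
      ≡⟨ cong₂ (λ u v → suc j * u + v) (rStirling-diag r (suc j)) (rStirling-diag r j) ⟩
    suc j * δ (suc j) r + δ j r
      ≡⟨ cong (_+ δ j r) (*-δ (suc j) r) ⟩
    r * δ (suc j) r + δ j r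
      ≡⟨ ℕ.+-comm _ (δ j r) ⟩
    δ j r + r * δ (suc j) r
      ≡⟨ cong₂ (λ u v → u + r * v) (rStirling-diag (suc r) (suc j)) (rStirling-diag r (suc j)) ⟨
    rStirling (suc r) (suc r) (suc j) + r * rStirling r r (suc j) ∎
  rStirling-raise r (suc n) zero _ | after r≤n = begin
    rStirling r (suc (suc n)) 0
      ≡⟨ rStirling-suc-zero r (suc n) (ℕ.m≤n⇒m≤1+n r≤n) ⟩
    0
      ≡⟨ ℕ.*-zeroʳ r ⟨
    r * 0
      ≡⟨ cong₂ (λ u v → u + r * v) (rStirling-suc-zero (suc r) (suc n) (s≤s r≤n)) (rStirling-suc-zero r n r≤n) ⟨
    rStirling (suc r) (suc (suc n)) 0 + r * rStirling r (suc n) 0 ∎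
  rStirling-raise r (suc n) (suc j) _ | after r≤n = begin
    rStirling r (suc (suc n)) (suc j)
      ≡⟨ rStirling-suc r (suc n) j (ℕ.m≤n⇒m≤1+n r≤n) ⟩
    suc j * rStirling r (suc n) (suc j) + rStirling r (suc n) j
      ≡⟨ cong₂ (λ u v → suc j * u + v) (rStirling-raise r n (suc j) r≤n) (rStirling-raise r n j r≤n) ⟩
    suc j * (S′ (suc j) + r * S (suc j)) + (S′ j + r * S j)
      ≡⟨ regroup (suc j) r (S′ (suc j)) (S (suc j)) (S′ j) (S j) ⟩
    (suc j * S′ (suc j) + S′ j) + r * (suc j * S (suc j) + S j)
      ≡⟨ cong₂ (λ u v → u + r * v) (rStirling-suc (suc r) (suc n) j (s≤s r≤n)) (rStirling-suc r n j r≤n) ⟨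
    rStirling (suc r) (suc (suc n)) (suc j) + r * rStirling r (suc n) (suc j) ∎
    where
    S S′ : ℕ → ℕ
    S  = rStirling r n
    S′ = rStirling (suc r) (suc n)
    regroup : ∀ k r a b c d → k * (a + r * b) + (c + r * d) ≡ (k * a + c) + r * (k * b + d)
    regroup = solve-∀

module CoefficientProperties {c ℓ} (F : CharZeroField c ℓ) where
  open CharZeroField F hiding (_×_)
  open PowerSeries F
  open SetoidReasoning setoid
  module ≈-Reasoning = SetoidReasoning setoid
  module S = Solver commutativeSemiring

  ofℕ-+ : ∀ m n → ofℕ (m +ℕ n) ≈ ofℕ m + ofℕ n
  ofℕ-+ = MonoidMult.×-homo-+ +-monoid 1#

  ofℕ-* : ∀ m n → ofℕ (m *ℕ n) ≈ ofℕ m * ofℕ n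
  ofℕ-* = SemiringMult.×1-homo-* semiring

  ofℕ-1 : ofℕ 1 ≈ 1#
  ofℕ-1 = +-identityʳ 1#

  ofℕ-nonZero : ∀ n .{{_ : NonZero n}} → ¬ (ofℕ n ≈ 0#)
  ofℕ-nonZero (suc n) = charZero n

  fact-nonZero : ∀ n → NonZero (fact n)
  fact-nonZero zero    = _
  fact-nonZero (suc n) = ℕ.m*n≢0 (suc n) (fact n) {{_}} {{fact-nonZero n}}

  ofℕ-fact-nonZero : ∀ n → ¬ (ofℕ (fact n) ≈ 0#)
  ofℕ-fact-nonZero n = ofℕ-nonZero (fact n) {{fact-nonZero n}}

  inverseˡ : ∀ a → ¬ (a ≈ 0#) → a ⁻¹ * a ≈ 1#
  inverseˡ a a≉0 = trans (*-comm _ _) (inverseʳ a a≉0)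

  *-cancelˡ : ∀ {a u v} → ¬ (a ≈ 0#) → a * u ≈ a * v → u ≈ v
  *-cancelˡ {a} {u} {v} a≉0 au≈av = begin
    u              ≈⟨ *-identityˡ u ⟨
    1# * u         ≈⟨ *-congʳ (inverseˡ a a≉0) ⟨
    (a ⁻¹ * a) * u ≈⟨ *-assoc _ _ _ ⟩
    a ⁻¹ * (a * u) ≈⟨ *-congˡ au≈av ⟩
    a ⁻¹ * (a * v) ≈⟨ *-assoc _ _ _ ⟨
    (a ⁻¹ * a) * v ≈⟨ *-congʳ (inverseˡ a a≉0) ⟩
    1# * v         ≈⟨ *-identityˡ v ⟩
    v              ∎

  ⁻¹-unique : ∀ {a b} → ¬ (a ≈ 0#) → a * b ≈ 1# → b ≈ a ⁻¹
  ⁻¹-unique {a} {b} a≉0 ab≈1 = *-cancelˡ a≉0 (trans ab≈1 (sym (inverseʳ a a≉0)))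

  fact⁻¹ : ℕ → Carrier
  fact⁻¹ n = ofℕ (fact n) ⁻¹

  fact⁻¹-zero : fact⁻¹ 0 ≈ 1#
  fact⁻¹-zero = sym (⁻¹-unique (ofℕ-fact-nonZero 0) (trans (*-identityʳ _) ofℕ-1))

  fact⁻¹-suc : ∀ n → ofℕ (suc n) * fact⁻¹ (suc n) ≈ fact⁻¹ n
  fact⁻¹-suc n = ⁻¹-unique (ofℕ-fact-nonZero n) (begin
    ofℕ (fact n) * (ofℕ (suc n) * fact⁻¹ (suc n)) ≈⟨ *-assoc _ _ _ ⟨
    (ofℕ (fact n) * ofℕ (suc n)) * fact⁻¹ (suc n) ≈⟨ *-congʳ (trans (*-comm _ _) (sym (ofℕ-* (suc n) (fact n)))) ⟩
    ofℕ (fact (suc n)) * fact⁻¹ (suc n)           ≈⟨ inverseʳ _ (ofℕ-fact-nonZero (suc n)) ⟩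
    1#                                            ∎)

  fact⁻¹-*-fact : ∀ n → fact⁻¹ n * ofℕ (fact n) ≈ 1#
  fact⁻¹-*-fact n = inverseˡ _ (ofℕ-fact-nonZero n)

  sumTo-cong≤ : ∀ n {f g : ℕ → Carrier} → (∀ k → k ≤ n → f k ≈ g k) → sumTo n f ≈ sumTo n g
  sumTo-cong≤ zero    f≈g = f≈g 0 z≤n
  sumTo-cong≤ (suc n) f≈g =
    +-cong (sumTo-cong≤ n (λ k k≤n → f≈g k (ℕ.m≤n⇒m≤1+n k≤n))) (f≈g (suc n) ℕ.≤-refl)

  sumTo-cong : ∀ n {f g : ℕ → Carrier} → (∀ k → f k ≈ g k) → sumTo n f ≈ sumTo n g
  sumTo-cong n f≈g = sumTo-cong≤ n (λ k _ → f≈g k)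

  sumTo-zero : ∀ n {f : ℕ → Carrier} → (∀ k → k ≤ n → f k ≈ 0#) → sumTo n f ≈ 0#
  sumTo-zero zero    f≈0 = f≈0 0 z≤n
  sumTo-zero (suc n) f≈0 = trans (+-cong (sumTo-zero n (λ k k≤n → f≈0 k (ℕ.m≤n⇒m≤1+n k≤n)))
                                         (f≈0 (suc n) ℕ.≤-refl))
                                 (+-identityʳ 0#)

  sumTo-+ : ∀ n (f g : ℕ → Carrier) → sumTo n (λ k → f k + g k) ≈ sumTo n f + sumTo n g
  sumTo-+ zero    f g = refl
  sumTo-+ (suc n) f g = trans (+-congʳ (sumTo-+ n f g))
    (S.solve 4 (λ a b c d → (a S.:+ b) S.:+ (c S.:+ d) S.:= (a S.:+ c) S.:+ (b S.:+ d)) refl _ _ _ _)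

  *-distribˡ-sumTo : ∀ n a (f : ℕ → Carrier) → a * sumTo n f ≈ sumTo n (λ k → a * f k)
  *-distribˡ-sumTo zero    a f = refl
  *-distribˡ-sumTo (suc n) a f = trans (distribˡ _ _ _) (+-congʳ (*-distribˡ-sumTo n a f))

  sumTo-suc : ∀ n (f : ℕ → Carrier) → sumTo (suc n) f ≈ f 0 + sumTo n (λ k → f (suc k))
  sumTo-suc zero    f = refl
  sumTo-suc (suc n) f = trans (+-congʳ (sumTo-suc n f)) (+-assoc _ _ _)

  sumTo-comm : ∀ m n (f : ℕ → ℕ → Carrier) →
    sumTo m (λ j → sumTo n (f j)) ≈ sumTo n (λ k → sumTo m (λ j → f j k))
  sumTo-comm zero    n f = refl
  sumTo-comm (suc m) n f =
    trans (+-congʳ (sumTo-comm m n f)) (sym (sumTo-+ n (λ k → sumTo m (λ j → f j k)) (f (suc m))))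

  sumTo-extend : ∀ {m n} (f : ℕ → Carrier) → m ≤ n → (∀ k → m < k → f k ≈ 0#) → sumTo n f ≈ sumTo m f
  sumTo-extend {m} {n} f m≤n f≈0 with ℕ.m≤n⇒m<n∨m≡n m≤n
  ... | inj₂ ≡.refl = refl
  sumTo-extend {m} {suc n} f _ f≈0 | inj₁ (s≤s m≤n) =
    trans (+-cong (sumTo-extend f m≤n f≈0) (f≈0 (suc n) (s≤s m≤n))) (+-identityʳ _)

module ExplicitFormula {c ℓ} (F : CharZeroField c ℓ) where
  open CharZeroField F hiding (_×_)
  open PowerSeries F
  open CoefficientProperties F
  open RStirlingProperties
  open CommSemigroupProperties *-commutativeSemigroup using (x∙yz≈y∙xz)

  module _ (x y : Carrier) (a : ℕ → ℕ → Carrier)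
           (rec : ∀ n m → a (suc n) m ≈ (x * (ofℕ (suc m) * a n (suc m)) + y * (ofℕ m * a n m))) where

    summand : ℕ → ℕ → ℕ → ℕ → Carrier
    summand σ n m k = ofℕ σ * ofℕ (fact (k +ℕ m)) * (y ^ (n ∸ k)) * (x ^ k) * a 0 (m +ℕ k)

    term : ℕ → ℕ → ℕ → Carrier
    term n m k = summand (rStirling m (n +ℕ m) (k +ℕ m)) n m k

    summand-zero : ∀ {σ} n m k → σ ≡ 0 → summand σ n m k ≈ 0#
    summand-zero n m k ≡.refl =
      S.solve 4 (λ f p q r → (((S.con 0 S.:* f) S.:* p) S.:* q) S.:* r S.:= S.con 0) refl _ _ _ _

    term-split : ∀ n m k → term (suc n) m k ≈
        summand (rStirling (suc m) (suc n +ℕ m) (k +ℕ m)) (suc n) m k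
      + ofℕ m * summand (rStirling m (n +ℕ m) (k +ℕ m)) (suc n) m k
    term-split n m k = begin
      ofℕ (rStirling m (suc n +ℕ m) (k +ℕ m)) * f * p * q * r
        ≈⟨ *-congʳ (*-congʳ (*-congʳ (*-congʳ stirling))) ⟩
      (ofℕ σ′ + ofℕ m * ofℕ σ) * f * p * q * r
        ≈⟨ S.solve 7 (λ A M B f p q r → ((((A S.:+ M S.:* B) S.:* f) S.:* p) S.:* q) S.:* r
                                S.:= ((((A S.:* f) S.:* p) S.:* q) S.:* r) S.:+ M S.:* ((((B S.:* f) S.:* p) S.:* q) S.:* r))
             refl (ofℕ σ′) (ofℕ m) (ofℕ σ) f p q r ⟩
      summand σ′ (suc n) m k + ofℕ m * summand σ (suc n) m k ∎
      where
      open ≈-Reasoning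
      σ σ′ : ℕ
      σ  = rStirling m (n +ℕ m) (k +ℕ m)
      σ′ = rStirling (suc m) (suc n +ℕ m) (k +ℕ m)
      f p q r : Carrier
      f = ofℕ (fact (k +ℕ m))
      p = y ^ (suc n ∸ k)
      q = x ^ k
      r = a 0 (m +ℕ k)
      stirling : ofℕ (rStirling m (suc n +ℕ m) (k +ℕ m)) ≈ ofℕ σ′ + ofℕ m * ofℕ σ
      stirling = begin
        ofℕ (rStirling m (suc n +ℕ m) (k +ℕ m))
          ≈⟨ reflexive (≡.cong ofℕ (rStirling-raise m (n +ℕ m) (k +ℕ m) (ℕ.m≤n+m m n))) ⟩
        ofℕ (σ′ +ℕ m *ℕ σ)
          ≈⟨ trans (ofℕ-+ σ′ (m *ℕ σ)) (+-congˡ (ofℕ-* m σ)) ⟩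
        ofℕ σ′ + ofℕ m * ofℕ σ ∎

    summand-lower : ∀ n m k → k ≤ n →
      summand (rStirling m (n +ℕ m) (k +ℕ m)) (suc n) m k ≈ y * term n m k
    summand-lower n m k k≤n rewrite ℕ.+-∸-assoc 1 k≤n =
      S.solve 6 (λ σ f y′ p q r → (((σ S.:* f) S.:* (y′ S.:* p)) S.:* q) S.:* r
                             S.:= y′ S.:* ((((σ S.:* f) S.:* p) S.:* q) S.:* r))
        refl _ _ _ _ _ _

    summand-raise : ∀ n m k →
      summand (rStirling (suc m) (suc n +ℕ m) (suc k +ℕ m)) (suc n) m (suc k) ≈ x * term n (suc m) k
    summand-raise n m k rewrite ℕ.+-suc n m | ℕ.+-suc k m | ℕ.+-suc m k =
      S.solve 6 (λ σ f p x′ q r → (((σ S.:* f) S.:* p) S.:* (x′ S.:* q)) S.:* r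
                             S.:= x′ S.:* ((((σ S.:* f) S.:* p) S.:* q) S.:* r))
        refl _ _ _ _ _ _

    sumTo-term-suc : ∀ n m →
      sumTo (suc n) (term (suc n) m) ≈ x * sumTo n (term n (suc m)) + y * (ofℕ m * sumTo n (term n m))
    sumTo-term-suc n m = begin
      sumTo (suc n) (term (suc n) m)
        ≈⟨ trans (sumTo-cong (suc n) (term-split n m)) (sumTo-+ (suc n) U (λ k → ofℕ m * V k)) ⟩
      sumTo (suc n) U + (sumTo n (λ k → ofℕ m * V k) + ofℕ m * V (suc n))
        ≈⟨ +-congʳ (sumTo-suc n U) ⟩
      (U 0 + sumTo n (λ k → U (suc k))) + (sumTo n (λ k → ofℕ m * V k) + ofℕ m * V (suc n))
        ≈⟨ +-cong (+-cong U-zero (sumTo-cong n (summand-raise n m)))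
                  (+-cong (sumTo-cong≤ n (λ k k≤n → *-congˡ (summand-lower n m k k≤n))) (*-congˡ V-top)) ⟩
      (0# + sumTo n (λ k → x * term n (suc m) k)) + (sumTo n (λ k → ofℕ m * (y * term n m k)) + ofℕ m * 0#)
        ≈⟨ +-cong (+-identityˡ _) (trans (+-congˡ (zeroʳ _)) (+-identityʳ _)) ⟩
      sumTo n (λ k → x * term n (suc m) k) + sumTo n (λ k → ofℕ m * (y * term n m k))
        ≈⟨ +-congˡ (sumTo-cong n (λ k → x∙yz≈y∙xz (ofℕ m) y _)) ⟩
      sumTo n (λ k → x * term n (suc m) k) + sumTo n (λ k → y * (ofℕ m * term n m k))
        ≈⟨ +-cong (sym (*-distribˡ-sumTo n x _))
                  (trans (sym (*-distribˡ-sumTo n y _)) (*-congˡ (sym (*-distribˡ-sumTo n (ofℕ m) _)))) ⟩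
      x * sumTo n (term n (suc m)) + y * (ofℕ m * sumTo n (term n m)) ∎
      where
      open ≈-Reasoning
      U V : ℕ → Carrier
      U k = summand (rStirling (suc m) (suc n +ℕ m) (k +ℕ m)) (suc n) m k
      V k = summand (rStirling m (n +ℕ m) (k +ℕ m)) (suc n) m k
      U-zero : U 0 ≈ 0#
      U-zero = summand-zero (suc n) m 0 (rStirling-below (suc m) (suc n +ℕ m) m ℕ.≤-refl)
      V-top : V (suc n) ≈ 0#
      V-top = summand-zero (suc n) m (suc n) (rStirling-above m (n +ℕ m) (suc n +ℕ m) ℕ.≤-refl)

    explicit-formula : ∀ n m → a n m ≈ fact⁻¹ m * sumTo n (term n m)
    explicit-formula zero    m = begin
      a 0 m
        ≈⟨ *-identityˡ _ ⟨
      1# * a 0 m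
        ≈⟨ *-congʳ (fact⁻¹-*-fact m) ⟨
      (fact⁻¹ m * ofℕ (fact m)) * a 0 m
        ≈⟨ S.solve 3 (λ i f r → (i S.:* f) S.:* r
                          S.:= i S.:* ((((S.con 1 S.:* f) S.:* S.con 1) S.:* S.con 1) S.:* r)) refl _ _ _ ⟩
      fact⁻¹ m * ((((1# * ofℕ (fact m)) * 1#) * 1#) * a 0 m)
        ≈⟨ *-congˡ (*-cong (*-congʳ (*-congʳ (*-congʳ 1≈stirling)))
                           (reflexive (≡.cong (a 0) (≡.sym (ℕ.+-identityʳ m))))) ⟩
      fact⁻¹ m * term 0 m 0 ∎
      where
      open ≈-Reasoning
      1≈stirling : 1# ≈ ofℕ (rStirling m m m)
      1≈stirling = trans (sym ofℕ-1) (reflexive (≡.cong ofℕ (≡.sym (≡.trans (rStirling-diag m m) (δ-refl m)))))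
    explicit-formula (suc n) m = begin
      a (suc n) m
        ≈⟨ rec n m ⟩
      x * (ofℕ (suc m) * a n (suc m)) + y * (ofℕ m * a n m)
        ≈⟨ +-cong (*-congˡ (*-congˡ (explicit-formula n (suc m)))) (*-congˡ (*-congˡ (explicit-formula n m))) ⟩
      x * (ofℕ (suc m) * (fact⁻¹ (suc m) * Σ′)) + y * (ofℕ m * (fact⁻¹ m * Σ))
        ≈⟨ +-cong (*-congˡ (trans (sym (*-assoc _ _ _)) (*-congʳ (fact⁻¹-suc m)))) (*-congˡ (x∙yz≈y∙xz _ _ _)) ⟩
      x * (fact⁻¹ m * Σ′) + y * (fact⁻¹ m * (ofℕ m * Σ))
        ≈⟨ +-cong (x∙yz≈y∙xz _ _ _) (x∙yz≈y∙xz _ _ _) ⟩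
      fact⁻¹ m * (x * Σ′) + fact⁻¹ m * (y * (ofℕ m * Σ))
        ≈⟨ distribˡ _ _ _ ⟨
      fact⁻¹ m * (x * Σ′ + y * (ofℕ m * Σ))
        ≈⟨ *-congˡ (sumTo-term-suc n m) ⟨
      fact⁻¹ m * sumTo (suc n) (term (suc n) m) ∎
      where
      open ≈-Reasoning
      Σ Σ′ : Carrier
      Σ  = sumTo n (term n m)
      Σ′ = sumTo n (term n (suc m))

module PowerSeriesProperties {c ℓ} (F : CharZeroField c ℓ) where
  open CharZeroField F hiding (_×_)
  open PowerSeries F
  open CoefficientProperties F public
  open SetoidReasoning setoid
  open CommSemigroupProperties *-commutativeSemigroup using (x∙yz≈y∙xz)

  tailS : PS → PS
  tailS f n = f (suc n)

  𝟘 𝟙 : PS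
  𝟘 _ = 0#
  𝟙   = const 1#

  ≋-setoid : Setoid c ℓ
  ≋-setoid = record
    { Carrier       = PS
    ; _≈_           = _≋_
    ; isEquivalence = record
      { refl  = λ n → refl
      ; sym   = λ f≋g n → sym (f≋g n)
      ; trans = λ f≋g g≋h n → trans (f≋g n) (g≋h n)
      }
    }

  open Setoid ≋-setoid public using ()
    renaming (refl to ≋-refl; sym to ≋-sym; trans to ≋-trans; reflexive to ≋-reflexive)

  ⊕-cong : ∀ {f f′ g g′} → f ≋ f′ → g ≋ g′ → (f ⊕ g) ≋ (f′ ⊕ g′)
  ⊕-cong f≋f′ g≋g′ n = +-cong (f≋f′ n) (g≋g′ n)

  ⊕-congˡ : ∀ f {g g′} → g ≋ g′ → (f ⊕ g) ≋ (f ⊕ g′)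
  ⊕-congˡ f = ⊕-cong {f = f} ≋-refl

  ⊛-cong : ∀ {f f′ g g′} → f ≋ f′ → g ≋ g′ → (f ⊛ g) ≋ (f′ ⊛ g′)
  ⊛-cong f≋f′ g≋g′ n = sumTo-cong n (λ k → *-cong (f≋f′ k) (g≋g′ (n ∸ k)))

  -- The unchanged factor is passed explicitly: unification cannot recover the factors from
  -- (f ⊛ g) n, where g occurs only applied to n ∸ k.
  ⊛-congˡ : ∀ f {g g′} → g ≋ g′ → (f ⊛ g) ≋ (f ⊛ g′)
  ⊛-congˡ f = ⊛-cong {f = f} ≋-refl

  ⊛-congʳ : ∀ h {f f′} → f ≋ f′ → (f ⊛ h) ≋ (f′ ⊛ h)
  ⊛-congʳ h f≋f′ = ⊛-cong {g = h} f≋f′ ≋-refl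

  ⊛-suc : ∀ f g n → (f ⊛ g) (suc n) ≈ f 0 * g (suc n) + (tailS f ⊛ g) n
  ⊛-suc f g n = sumTo-suc n _

  ⊛-zeroˡ : ∀ g → (𝟘 ⊛ g) ≋ 𝟘
  ⊛-zeroˡ g n = sumTo-zero n (λ k _ → zeroˡ _)

  ⊛-distribʳ : ∀ h f g → ((f ⊕ g) ⊛ h) ≋ ((f ⊛ h) ⊕ (g ⊛ h))
  ⊛-distribʳ h f g n = trans (sumTo-cong n (λ k → distribʳ _ _ _)) (sumTo-+ n _ _)

  scale-⊛ : ∀ a f g → (scale a f ⊛ g) ≋ scale a (f ⊛ g)
  scale-⊛ a f g n = trans (sumTo-cong n (λ k → *-assoc _ _ _)) (sym (*-distribˡ-sumTo n a _))

  const-⊛ : ∀ a f → (const a ⊛ f) ≋ scale a f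
  const-⊛ a f zero    = refl
  const-⊛ a f (suc n) = trans (⊛-suc (const a) f n) (trans (+-congˡ (⊛-zeroˡ f n)) (+-identityʳ _))

  ⊛-identityˡ : ∀ f → (𝟙 ⊛ f) ≋ f
  ⊛-identityˡ f n = trans (const-⊛ 1# f n) (*-identityˡ _)

  ⊛-assoc : ∀ f g h → ((f ⊛ g) ⊛ h) ≋ (f ⊛ (g ⊛ h))
  ⊛-assoc f g h zero    = *-assoc _ _ _
  ⊛-assoc f g h (suc n) = begin
    ((f ⊛ g) ⊛ h) (suc n)
      ≈⟨ ⊛-suc (f ⊛ g) h n ⟩
    (f 0 * g 0) * h (suc n) + (tailS (f ⊛ g) ⊛ h) n
      ≈⟨ +-congˡ (⊛-congʳ h (⊛-suc f g) n) ⟩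
    (f 0 * g 0) * h (suc n) + ((scale (f 0) (tailS g) ⊕ (tailS f ⊛ g)) ⊛ h) n
      ≈⟨ +-congˡ (⊛-distribʳ h _ _ n) ⟩
    (f 0 * g 0) * h (suc n) + ((scale (f 0) (tailS g) ⊛ h) n + ((tailS f ⊛ g) ⊛ h) n)
      ≈⟨ +-congˡ (+-cong (scale-⊛ (f 0) (tailS g) h n) (⊛-assoc (tailS f) g h n)) ⟩
    (f 0 * g 0) * h (suc n) + (f 0 * (tailS g ⊛ h) n + (tailS f ⊛ (g ⊛ h)) n)
      ≈⟨ S.solve 5 (λ a b c d e → (a S.:* b) S.:* c S.:+ (a S.:* d S.:+ e)
                           S.:= a S.:* (b S.:* c S.:+ d) S.:+ e) refl _ _ _ _ _ ⟩
    f 0 * (g 0 * h (suc n) + (tailS g ⊛ h) n) + (tailS f ⊛ (g ⊛ h)) n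
      ≈⟨ +-congʳ (*-congˡ (⊛-suc g h n)) ⟨
    f 0 * (g ⊛ h) (suc n) + (tailS f ⊛ (g ⊛ h)) n
      ≈⟨ ⊛-suc f (g ⊛ h) n ⟨
    (f ⊛ (g ⊛ h)) (suc n) ∎

  ⊛-comm : ∀ f g → (f ⊛ g) ≋ (g ⊛ f)
  ⊛-comm f g zero          = *-comm _ _
  ⊛-comm f g (suc zero)    = begin
    f 0 * g 1 + f 1 * g 0 ≈⟨ +-comm _ _ ⟩
    f 1 * g 0 + f 0 * g 1 ≈⟨ +-cong (*-comm _ _) (*-comm _ _) ⟩
    g 0 * f 1 + g 1 * f 0 ∎
  ⊛-comm f g (suc (suc n)) = begin
    (f ⊛ g) (suc (suc n))
      ≈⟨ ⊛-suc f g (suc n) ⟩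
    f 0 * g (2 +ℕ n) + (tailS f ⊛ g) (suc n)
      ≈⟨ +-congˡ (⊛-comm (tailS f) g (suc n)) ⟩
    f 0 * g (2 +ℕ n) + (g ⊛ tailS f) (suc n)
      ≈⟨ +-congˡ (⊛-suc g (tailS f) n) ⟩
    f 0 * g (2 +ℕ n) + (g 0 * f (2 +ℕ n) + (tailS g ⊛ tailS f) n)
      ≈⟨ +-congˡ (+-congˡ (⊛-comm (tailS g) (tailS f) n)) ⟩
    f 0 * g (2 +ℕ n) + (g 0 * f (2 +ℕ n) + (tailS f ⊛ tailS g) n)
      ≈⟨ S.solve 3 (λ a b c → a S.:+ (b S.:+ c) S.:= b S.:+ (a S.:+ c)) refl _ _ _ ⟩
    g 0 * f (2 +ℕ n) + (f 0 * g (2 +ℕ n) + (tailS f ⊛ tailS g) n)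
      ≈⟨ +-congˡ (⊛-suc f (tailS g) n) ⟨
    g 0 * f (2 +ℕ n) + (f ⊛ tailS g) (suc n)
      ≈⟨ +-congˡ (⊛-comm (tailS g) f (suc n)) ⟨
    g 0 * f (2 +ℕ n) + (tailS g ⊛ f) (suc n)
      ≈⟨ ⊛-suc g f (suc n) ⟨
    (g ⊛ f) (suc (suc n)) ∎

  ⊛-zeroʳ : ∀ f → (f ⊛ 𝟘) ≋ 𝟘
  ⊛-zeroʳ f = ≋-trans (⊛-comm f 𝟘) (⊛-zeroˡ f)

  PS-commutativeSemiring : CommutativeSemiring c ℓ
  PS-commutativeSemiring = record
    { Carrier = PS ; _≈_ = _≋_ ; _+_ = _⊕_ ; _*_ = _⊛_ ; 0# = 𝟘 ; 1# = 𝟙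
    ; isCommutativeSemiring = isCommutativeSemiringˡ record
      { +-isCommutativeMonoid = record
        { isMonoid = record
          { isSemigroup = record
            { isMagma = record { isEquivalence = Setoid.isEquivalence ≋-setoid ; ∙-cong = ⊕-cong }
            ; assoc   = λ f g h n → +-assoc _ _ _
            }
          ; identity = (λ f n → +-identityˡ _) , (λ f n → +-identityʳ _)
          }
        ; comm = λ f g n → +-comm _ _
        }
      ; *-isCommutativeMonoid = isCommutativeMonoidˡ record
        { isSemigroup = record
          { isMagma = record { isEquivalence = Setoid.isEquivalence ≋-setoid ; ∙-cong = ⊛-cong }
          ; assoc   = ⊛-assoc
          }
        ; identityˡ = ⊛-identityˡ
        ; comm      = ⊛-comm
        }
      ; distribʳ = ⊛-distribʳ
      ; zeroˡ    = ⊛-zeroˡ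
      }
    }

  module PS = Solver PS-commutativeSemiring
  module ≋-Reasoning = SetoidReasoning ≋-setoid

  const-+ : ∀ a b → const (a + b) ≋ (const a ⊕ const b)
  const-+ a b zero    = refl
  const-+ a b (suc n) = sym (+-identityʳ 0#)

  const-* : ∀ a b → const (a * b) ≋ (const a ⊛ const b)
  const-* a b zero    = refl
  const-* a b (suc n) = sym (trans (const-⊛ a (const b) (suc n)) (zeroʳ a))

  const-cong : ∀ {a b} → a ≈ b → const a ≋ const b
  const-cong a≈b zero    = a≈b
  const-cong a≈b (suc n) = refl

  deriv-cong : ∀ {f g} → f ≋ g → deriv f ≋ deriv g
  deriv-cong f≋g n = *-congˡ (f≋g (suc n))

  deriv-⊕ : ∀ f g → deriv (f ⊕ g) ≋ (deriv f ⊕ deriv g)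
  deriv-⊕ f g n = distribˡ _ _ _

  deriv-const : ∀ a → deriv (const a) ≋ 𝟘
  deriv-const a n = zeroʳ _

  euler : PS → PS
  euler f n = ofℕ n * f n

  euler-⊛ : ∀ f g → euler (f ⊛ g) ≋ ((euler f ⊛ g) ⊕ (f ⊛ euler g))
  euler-⊛ f g n = begin
    ofℕ n * sumTo n (λ k → f k * g (n ∸ k))
      ≈⟨ *-distribˡ-sumTo n _ _ ⟩
    sumTo n (λ k → ofℕ n * (f k * g (n ∸ k)))
      ≈⟨ sumTo-cong≤ n split ⟩
    sumTo n (λ k → (ofℕ k * f k) * g (n ∸ k) + f k * (ofℕ (n ∸ k) * g (n ∸ k)))
      ≈⟨ sumTo-+ n _ _ ⟩
    ((euler f ⊛ g) ⊕ (f ⊛ euler g)) n ∎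
    where
    split : ∀ k → k ≤ n →
      ofℕ n * (f k * g (n ∸ k)) ≈ (ofℕ k * f k) * g (n ∸ k) + f k * (ofℕ (n ∸ k) * g (n ∸ k))
    split k k≤n = begin
      ofℕ n * (f k * g (n ∸ k))
        ≈⟨ *-congʳ (reflexive (≡.cong ofℕ (ℕ.m+[n∸m]≡n k≤n))) ⟨
      ofℕ (k +ℕ (n ∸ k)) * (f k * g (n ∸ k))
        ≈⟨ *-congʳ (ofℕ-+ k (n ∸ k)) ⟩
      (ofℕ k + ofℕ (n ∸ k)) * (f k * g (n ∸ k))
        ≈⟨ S.solve 4 (λ a b p q → (a S.:+ b) S.:* (p S.:* q)
                             S.:= (a S.:* p) S.:* q S.:+ p S.:* (b S.:* q)) refl _ _ _ _ ⟩
      (ofℕ k * f k) * g (n ∸ k) + f k * (ofℕ (n ∸ k) * g (n ∸ k)) ∎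

  euler-⊛-suc : ∀ f g n → (euler f ⊛ g) (suc n) ≈ (deriv f ⊛ g) n
  euler-⊛-suc f g n = trans (⊛-suc (euler f) g n)
    (trans (+-congʳ (trans (*-congʳ (zeroˡ (f 0))) (zeroˡ _))) (+-identityˡ _))

  deriv-⊛ : ∀ f g → deriv (f ⊛ g) ≋ ((deriv f ⊛ g) ⊕ (f ⊛ deriv g))
  deriv-⊛ f g n = begin
    euler (f ⊛ g) (suc n)                         ≈⟨ euler-⊛ f g (suc n) ⟩
    (euler f ⊛ g) (suc n) + (f ⊛ euler g) (suc n) ≈⟨ +-congˡ (⊛-comm f (euler g) (suc n)) ⟩
    (euler f ⊛ g) (suc n) + (euler g ⊛ f) (suc n) ≈⟨ +-cong (euler-⊛-suc f g n) (euler-⊛-suc g f n) ⟩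
    (deriv f ⊛ g) n + (deriv g ⊛ f) n             ≈⟨ +-congˡ (⊛-comm (deriv g) f n) ⟩
    (deriv f ⊛ g) n + (f ⊛ deriv g) n             ∎

  deriv-const-⊛ : ∀ a f → deriv (const a ⊛ f) ≋ (const a ⊛ deriv f)
  deriv-const-⊛ a f = ≋-trans (deriv-⊛ (const a) f)
    (≋-trans (⊕-cong (⊛-congʳ f (deriv-const a)) ≋-refl)
    (PS.solve 2 (λ f′ a′ → PS.con 0 PS.:* f′ PS.:+ a′ PS.:= a′) ≋-refl f (const a ⊛ deriv f)))

  deriv-induction : ∀ {I : Set} {f g : I → PS} → (∀ i → f i 0 ≈ g i 0) →
    (∀ n → (∀ i → f i n ≈ g i n) → ∀ i → deriv (f i) n ≈ deriv (g i) n) → ∀ i → f i ≋ g i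
  deriv-induction base step i zero    = base i
  deriv-induction base step i (suc n) =
    *-cancelˡ (charZero n) (step n (λ j → deriv-induction base step j n) i)

  linear-ode-unique : ∀ a {f g} → deriv f ≋ (const a ⊛ f) → deriv g ≋ (const a ⊛ g) → f 0 ≈ g 0 → f ≋ g
  linear-ode-unique a {f} {g} f′≋af g′≋ag f0≈g0 = deriv-induction (λ _ → f0≈g0) step tt
    where
    step : ∀ n → (∀ _ → f n ≈ g n) → ∀ _ → deriv f n ≈ deriv g n
    step n ih _ = begin
      deriv f n       ≈⟨ trans (f′≋af n) (const-⊛ a f n) ⟩
      a * f n         ≈⟨ *-congˡ (ih tt) ⟩
      a * g n         ≈⟨ trans (g′≋ag n) (const-⊛ a g n) ⟨
      deriv g n       ∎

  linear-system-unique : ∀ (α β : ℕ → Carrier) {f g : ℕ → PS} →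
    (∀ s → deriv (f s) ≋ ((const (α s) ⊛ f (suc s)) ⊕ (const (β s) ⊛ f s))) →
    (∀ s → deriv (g s) ≋ ((const (α s) ⊛ g (suc s)) ⊕ (const (β s) ⊛ g s))) →
    (∀ s → f s 0 ≈ g s 0) → ∀ s → f s ≋ g s
  linear-system-unique α β {f} {g} f′≋ g′≋ f0≈g0 = deriv-induction f0≈g0 step
    where
    step : ∀ n → (∀ s → f s n ≈ g s n) → ∀ s → deriv (f s) n ≈ deriv (g s) n
    step n ih s = begin
      deriv (f s) n                   ≈⟨ unfold f f′≋ ⟩
      α s * f (suc s) n + β s * f s n ≈⟨ +-cong (*-congˡ (ih (suc s))) (*-congˡ (ih s)) ⟩
      α s * g (suc s) n + β s * g s n ≈⟨ unfold g g′≋ ⟨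
      deriv (g s) n                   ∎
      where
      unfold : ∀ k → (∀ s → deriv (k s) ≋ ((const (α s) ⊛ k (suc s)) ⊕ (const (β s) ⊛ k s))) →
               deriv (k s) n ≈ α s * k (suc s) n + β s * k s n
      unfold k k′≋ = trans (k′≋ s n) (+-cong (const-⊛ (α s) (k (suc s)) n) (const-⊛ (β s) (k s) n))

  expS-zeroth : ∀ a → expS a 0 ≈ 1#
  expS-zeroth a = trans (*-identityˡ _) fact⁻¹-zero

  expS-zero : expS 0# ≋ 𝟙
  expS-zero zero    = expS-zeroth 0#
  expS-zero (suc n) = trans (*-congʳ (zeroˡ _)) (zeroˡ _)

  expS-cong : ∀ {a b} → a ≈ b → expS a ≋ expS b
  expS-cong {a} {b} a≈b n = *-congʳ (^-congˡ n a≈b)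
    where open SemiringExp semiring using (^-congˡ)

  deriv-expS : ∀ a → deriv (expS a) ≋ (const a ⊛ expS a)
  deriv-expS a n = sym (begin
    (const a ⊛ expS a) n                      ≈⟨ const-⊛ a (expS a) n ⟩
    a * ((a ^ n) * fact⁻¹ n)                  ≈⟨ *-congˡ (*-congˡ (fact⁻¹-suc n)) ⟨
    a * ((a ^ n) * (ofℕ (suc n) * fact⁻¹ (suc n)))
      ≈⟨ S.solve 4 (λ a p k i → a S.:* (p S.:* (k S.:* i)) S.:= k S.:* ((a S.:* p) S.:* i)) refl _ _ _ _ ⟩
    ofℕ (suc n) * ((a * (a ^ n)) * fact⁻¹ (suc n)) ∎)

  expS-+ : ∀ a b → (expS a ⊛ expS b) ≋ expS (a + b)
  expS-+ a b = linear-ode-unique (a + b) deriv-product (deriv-expS (a + b))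
    (trans (*-cong (expS-zeroth a) (expS-zeroth b)) (trans (*-identityˡ 1#) (sym (expS-zeroth (a + b)))))
    where
    deriv-product : deriv (expS a ⊛ expS b) ≋ (const (a + b) ⊛ (expS a ⊛ expS b))
    deriv-product = ≋-trans (deriv-⊛ (expS a) (expS b))
      (≋-trans (⊕-cong (⊛-congʳ (expS b) (deriv-expS a)) (⊛-congˡ (expS a) (deriv-expS b)))
      (≋-trans (PS.solve 4 (λ p q u v → (p PS.:* u) PS.:* v PS.:+ u PS.:* (q PS.:* v) PS.:= (p PS.:+ q) PS.:* (u PS.:* v))
                  ≋-refl (const a) (const b) (expS a) (expS b))
      (⊛-congʳ (expS a ⊛ expS b) (≋-sym (const-+ a b)))))

  powS-vanish : ∀ {g} → g 0 ≈ 0# → ∀ k n → n < k → powS g k n ≈ 0#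
  powS-vanish {g} g0≈0 (suc k) n (s≤s n≤k) = sumTo-zero n term≈0
    where
    term≈0 : ∀ j → j ≤ n → g j * powS g k (n ∸ j) ≈ 0#
    term≈0 zero    _   = trans (*-congʳ g0≈0) (zeroˡ _)
    term≈0 (suc j) j<n = trans (*-congˡ (powS-vanish g0≈0 k (n ∸ suc j)
      (ℕ.<-≤-trans (ℕ.∸-monoʳ-< {o = 0} (s≤s z≤n) j<n) n≤k))) (zeroʳ _)

  compose-cong : ∀ {A B} g → A ≋ B → compose A g ≋ compose B g
  compose-cong g A≋B n = sumTo-cong n (λ k → *-congʳ (A≋B k))

  ⊛-compose : ∀ A {g} → g 0 ≈ 0# → ∀ n →
    (g ⊛ compose A g) n ≈ sumTo n (λ k → A k * powS g (suc k) n)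
  ⊛-compose A {g} g0≈0 n = begin
    sumTo n (λ j → g j * sumTo (n ∸ j) (λ k → A k * powS g k (n ∸ j)))
      ≈⟨ sumTo-cong≤ n (λ j j≤n → *-congˡ (sym (sumTo-extend _ (ℕ.m∸n≤m n j)
            (λ k n∸j<k → trans (*-congˡ (powS-vanish g0≈0 k (n ∸ j) n∸j<k)) (zeroʳ _))))) ⟩
    sumTo n (λ j → g j * sumTo n (λ k → A k * powS g k (n ∸ j)))
      ≈⟨ sumTo-cong n (λ j → *-distribˡ-sumTo n (g j) _) ⟩
    sumTo n (λ j → sumTo n (λ k → g j * (A k * powS g k (n ∸ j))))
      ≈⟨ sumTo-comm n n _ ⟩
    sumTo n (λ k → sumTo n (λ j → g j * (A k * powS g k (n ∸ j))))
      ≈⟨ sumTo-cong n (λ k → trans (sumTo-cong n (λ j → x∙yz≈y∙xz _ _ _)) (sym (*-distribˡ-sumTo n (A k) _))) ⟩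
    sumTo n (λ k → A k * powS g (suc k) n) ∎

  compose-shift : ∀ A {g} → g 0 ≈ 0# → compose A g ≋ (const (A 0) ⊕ (g ⊛ compose (tailS A) g))
  compose-shift A {g} g0≈0 zero    =
    trans (*-congʳ (sym (+-identityʳ _))) (trans (*-identityʳ _) (sym (+-congˡ (trans (*-congʳ g0≈0) (zeroˡ _)))))
  compose-shift A {g} g0≈0 (suc m) = begin
    sumTo (suc m) (λ k → A k * powS g k (suc m))
      ≈⟨ sumTo-suc m _ ⟩
    A 0 * 0# + sumTo m (λ k → A (suc k) * powS g (suc k) (suc m))
      ≈⟨ +-cong (zeroʳ _) (sym (sumTo-extend _ (ℕ.n≤1+n m)
           (λ k m<k → trans (*-congˡ (powS-vanish g0≈0 (suc k) (suc m) (s≤s m<k))) (zeroʳ _)))) ⟩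
    0# + sumTo (suc m) (λ k → A (suc k) * powS g (suc k) (suc m))
      ≈⟨ +-congˡ (⊛-compose (tailS A) g0≈0 (suc m)) ⟨
    0# + (g ⊛ compose (tailS A) g) (suc m) ∎

module Derivation {c ℓ} (F : CharZeroField c ℓ) (h : PowerSeries.PS F) where
  open CharZeroField F hiding (_×_)
  open PowerSeries F
  open PowerSeriesProperties F

  D : PS → PS
  D f = h ⊛ deriv f

  D-cong : ∀ {f g} → f ≋ g → D f ≋ D g
  D-cong f≋g = ⊛-congˡ h (deriv-cong f≋g)

  D-⊕ : ∀ f g → D (f ⊕ g) ≋ (D f ⊕ D g)
  D-⊕ f g = ≋-trans (⊛-congˡ h (deriv-⊕ f g))
    (PS.solve 3 (λ e p q → e PS.:* (p PS.:+ q) PS.:= e PS.:* p PS.:+ e PS.:* q) ≋-refl h (deriv f) (deriv g))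

  D-const-⊛ : ∀ a f → D (const a ⊛ f) ≋ (const a ⊛ D f)
  D-const-⊛ a f = ≋-trans (⊛-congˡ h (deriv-const-⊛ a f))
    (PS.solve 3 (λ e p q → e PS.:* (p PS.:* q) PS.:= p PS.:* (e PS.:* q)) ≋-refl h (const a) (deriv f))

  D-const : ∀ a → D (const a) ≋ 𝟘
  D-const a = ≋-trans (⊛-congˡ h (deriv-const a)) (⊛-zeroʳ h)

  D-⊛ : ∀ f g → D (f ⊛ g) ≋ ((D f ⊛ g) ⊕ (f ⊛ D g))
  D-⊛ f g = ≋-trans (⊛-congˡ h (deriv-⊛ f g))
    (PS.solve 5 (λ e p q p′ q′ → e PS.:* (p′ PS.:* q PS.:+ p PS.:* q′)
                            PS.:= (e PS.:* p′) PS.:* q PS.:+ p PS.:* (e PS.:* q′))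
       ≋-refl h f g (deriv f) (deriv g))

  deriv-via-D : ∀ {g} → (g ⊛ h) ≋ 𝟙 → ∀ f → deriv f ≋ (g ⊛ D f)
  deriv-via-D {g} gh≋1 f = begin
    deriv f              ≈⟨ ⊛-identityˡ (deriv f) ⟨
    𝟙 ⊛ deriv f          ≈⟨ ⊛-congʳ (deriv f) gh≋1 ⟨
    (g ⊛ h) ⊛ deriv f    ≈⟨ ⊛-assoc g h (deriv f) ⟩
    g ⊛ D f              ∎
    where open ≋-Reasoning

  iterate-sucʳ : ∀ j (φ : PS → PS) f → iterate (suc j) φ f ≡ iterate j φ (φ f)
  iterate-sucʳ zero    φ f = ≡.refl
  iterate-sucʳ (suc j) φ f = ≡.cong φ (iterate-sucʳ j φ f)

  D^ : ℕ → PS → PS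
  D^ j = iterate j D

  D^-cong : ∀ j {f g} → f ≋ g → D^ j f ≋ D^ j g
  D^-cong zero    f≋g = f≋g
  D^-cong (suc j) f≋g = D-cong (D^-cong j f≋g)

  D^-⊕ : ∀ j f g → D^ j (f ⊕ g) ≋ (D^ j f ⊕ D^ j g)
  D^-⊕ zero    f g = ≋-refl
  D^-⊕ (suc j) f g = ≋-trans (D-cong (D^-⊕ j f g)) (D-⊕ (D^ j f) (D^ j g))

  D^-const-⊛ : ∀ j a f → D^ j (const a ⊛ f) ≋ (const a ⊛ D^ j f)
  D^-const-⊛ zero    a f = ≋-refl
  D^-const-⊛ (suc j) a f = ≋-trans (D-cong (D^-const-⊛ j a f)) (D-const-⊛ a (D^ j f))

  D^-sucʳ : ∀ j f → D^ (suc j) f ≋ D^ j (D f)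
  D^-sucʳ j f = ≋-reflexive (iterate-sucʳ j D f)

  module _ {w : PS} (Dw≋1 : D w ≋ 𝟙) (w0≈0 : w 0 ≈ 0#) where

    D-powS : ∀ k → D (powS w (suc k)) ≋ (const (ofℕ (suc k)) ⊛ powS w k)
    D-powS zero    = begin
      D (w ⊛ 𝟙)                      ≈⟨ D-⊛ w 𝟙 ⟩
      (D w ⊛ 𝟙) ⊕ (w ⊛ D 𝟙)          ≈⟨ ⊕-cong (⊛-congʳ 𝟙 Dw≋1) (⊛-congˡ w (D-const 1#)) ⟩
      (𝟙 ⊛ 𝟙) ⊕ (w ⊛ 𝟘)              ≈⟨ ⊕-congˡ (𝟙 ⊛ 𝟙) (⊛-zeroʳ w) ⟩
      (𝟙 ⊛ 𝟙) ⊕ 𝟘                    ≈⟨ (λ n → +-identityʳ _) ⟩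
      𝟙 ⊛ 𝟙                          ≈⟨ ⊛-congʳ 𝟙 (const-cong ofℕ-1) ⟨
      const (ofℕ 1) ⊛ 𝟙              ∎
      where open ≋-Reasoning
    D-powS (suc k) = begin
      D (w ⊛ P)                      ≈⟨ D-⊛ w P ⟩
      (D w ⊛ P) ⊕ (w ⊛ D P)          ≈⟨ ⊕-cong (⊛-congʳ P Dw≋1) (⊛-congˡ w (D-powS k)) ⟩
      (𝟙 ⊛ P) ⊕ (w ⊛ (κ ⊛ Q))
        ≈⟨ PS.solve 3 (λ v q κ′ → PS.con 1 PS.:* (v PS.:* q) PS.:+ v PS.:* (κ′ PS.:* q)
                          PS.:= (PS.con 1 PS.:+ κ′) PS.:* (v PS.:* q)) ≋-refl w Q κ ⟩
      (𝟙 ⊕ κ) ⊛ P                    ≈⟨ ⊛-congʳ P (const-+ 1# (ofℕ (suc k))) ⟨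
      const (ofℕ (2 +ℕ k)) ⊛ P       ∎
      where
      open ≋-Reasoning
      Q P κ : PS
      Q = powS w k
      P = w ⊛ Q
      κ = const (ofℕ (suc k))

    D-powS-⊛ : ∀ k H →
      D (powS w (suc k) ⊛ H) ≋ ((const (ofℕ (suc k)) ⊛ (powS w k ⊛ H)) ⊕ (powS w (suc k) ⊛ D H))
    D-powS-⊛ k H = ≋-trans (D-⊛ (powS w (suc k)) H)
      (⊕-cong (≋-trans (⊛-congʳ H (D-powS k)) (⊛-assoc _ _ H)) ≋-refl)

    D^-powS-⊛ : ∀ j m H → D^ (suc j) (powS w (suc m) ⊛ H) ≋
      ((const (ofℕ (suc m)) ⊛ D^ j (powS w m ⊛ H)) ⊕ D^ j (powS w (suc m) ⊛ D H))
    D^-powS-⊛ j m H = begin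
      D^ (suc j) (powS w (suc m) ⊛ H)
        ≈⟨ D^-sucʳ j _ ⟩
      D^ j (D (powS w (suc m) ⊛ H))
        ≈⟨ D^-cong j (D-powS-⊛ m H) ⟩
      D^ j ((const (ofℕ (suc m)) ⊛ (powS w m ⊛ H)) ⊕ (powS w (suc m) ⊛ D H))
        ≈⟨ D^-⊕ j _ _ ⟩
      D^ j (const (ofℕ (suc m)) ⊛ (powS w m ⊛ H)) ⊕ D^ j (powS w (suc m) ⊛ D H)
        ≈⟨ ⊕-cong (D^-const-⊛ j _ _) ≋-refl ⟩
      (const (ofℕ (suc m)) ⊛ D^ j (powS w m ⊛ H)) ⊕ D^ j (powS w (suc m) ⊛ D H) ∎
      where open ≋-Reasoning

    D^-powS-⊛-zeroth-< : ∀ j m H → j < m → D^ j (powS w m ⊛ H) 0 ≈ 0#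
    D^-powS-⊛-zeroth-< zero    m       H 0<m       = trans (*-congʳ (powS-vanish w0≈0 m 0 0<m)) (zeroˡ _)
    D^-powS-⊛-zeroth-< (suc j) (suc m) H (s≤s j<m) = begin
      D^ (suc j) (powS w (suc m) ⊛ H) 0
        ≈⟨ D^-powS-⊛ j m H 0 ⟩
      ofℕ (suc m) * D^ j (powS w m ⊛ H) 0 + D^ j (powS w (suc m) ⊛ D H) 0
        ≈⟨ +-cong (*-congˡ (D^-powS-⊛-zeroth-< j m H j<m)) (D^-powS-⊛-zeroth-< j (suc m) (D H) (ℕ.m≤n⇒m≤1+n j<m)) ⟩
      ofℕ (suc m) * 0# + 0#
        ≈⟨ trans (+-identityʳ _) (zeroʳ _) ⟩
      0# ∎
      where open ≈-Reasoning

    D^-powS-⊛-zeroth : ∀ j H → D^ j (powS w j ⊛ H) 0 ≈ ofℕ (fact j) * H 0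
    D^-powS-⊛-zeroth zero    H = *-congʳ (sym ofℕ-1)
    D^-powS-⊛-zeroth (suc j) H = begin
      D^ (suc j) (powS w (suc j) ⊛ H) 0
        ≈⟨ D^-powS-⊛ j j H 0 ⟩
      ofℕ (suc j) * D^ j (powS w j ⊛ H) 0 + D^ j (powS w (suc j) ⊛ D H) 0
        ≈⟨ +-cong (*-congˡ (D^-powS-⊛-zeroth j H)) (D^-powS-⊛-zeroth-< j (suc j) (D H) ℕ.≤-refl) ⟩
      ofℕ (suc j) * (ofℕ (fact j) * H 0) + 0#
        ≈⟨ trans (+-identityʳ _) (trans (sym (*-assoc _ _ _)) (*-congʳ (sym (ofℕ-* (suc j) (fact j))))) ⟩
      ofℕ (fact (suc j)) * H 0 ∎
      where open ≈-Reasoning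

    D^-powS-vanish : ∀ s → D^ (suc s) (powS w s) ≋ 𝟘
    D^-powS-vanish zero    = D-const 1#
    D^-powS-vanish (suc s) = begin
      D^ (suc (suc s)) (powS w (suc s))           ≈⟨ D^-sucʳ (suc s) _ ⟩
      D^ (suc s) (D (powS w (suc s)))             ≈⟨ D^-cong (suc s) (D-powS s) ⟩
      D^ (suc s) (const (ofℕ (suc s)) ⊛ powS w s) ≈⟨ D^-const-⊛ (suc s) _ _ ⟩
      const (ofℕ (suc s)) ⊛ D^ (suc s) (powS w s) ≈⟨ ⊛-congˡ _ (D^-powS-vanish s) ⟩
      const (ofℕ (suc s)) ⊛ 𝟘                     ≈⟨ ⊛-zeroʳ _ ⟩
      𝟘                                           ∎
      where open ≋-Reasoning

module GeneratingFunction {c ℓ} (F : CharZeroField c ℓ) where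
  open CharZeroField F hiding (_×_)
  open PowerSeries F
  open PowerSeriesProperties F
  open import Algebra.Properties.Ring ring using (-0#≈0#)
  open CommSemigroupProperties *-commutativeSemigroup using (x∙yz≈y∙xz)

  module _ (x y : Carrier) (y≉0 : ¬ (y ≈ 0#)) (a : ℕ → ℕ → Carrier)
           (rec : ∀ n m → a (suc n) m ≈ (x * (ofℕ (suc m) * a n (suc m)) + y * (ofℕ m * a n m))) where
    open Derivation F (expS (- y))

    w u : PS
    w = scale (y ⁻¹) (expS y ⊖ const 1#)
    u = scale (x * y ⁻¹) (expS y ⊖ const 1#)

    expS-neg-inverse : (expS y ⊛ expS (- y)) ≋ 𝟙
    expS-neg-inverse = ≋-trans (expS-+ y (- y)) (≋-trans (expS-cong (-‿inverseʳ y)) expS-zero)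

    expS-⊖-1-zeroth : (expS y ⊖ const 1#) 0 ≈ 0#
    expS-⊖-1-zeroth = trans (+-congʳ (expS-zeroth y)) (-‿inverseʳ 1#)

    w-zeroth : w 0 ≈ 0#
    w-zeroth = trans (*-congˡ expS-⊖-1-zeroth) (zeroʳ _)

    u-zeroth : u 0 ≈ 0#
    u-zeroth = trans (*-congˡ expS-⊖-1-zeroth) (zeroʳ _)

    u≋x⊛w : u ≋ (const x ⊛ w)
    u≋x⊛w n = trans (*-assoc _ _ _) (sym (const-⊛ x w n))

    deriv-w : deriv w ≋ expS y
    deriv-w n = begin
      ofℕ (suc n) * (y ⁻¹ * (expS y (suc n) + - 0#))
        ≈⟨ *-congˡ (*-congˡ (trans (+-congˡ -0#≈0#) (+-identityʳ _))) ⟩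
      ofℕ (suc n) * (y ⁻¹ * expS y (suc n))
        ≈⟨ x∙yz≈y∙xz _ _ _ ⟩
      y ⁻¹ * deriv (expS y) n
        ≈⟨ *-congˡ (trans (deriv-expS y n) (const-⊛ y (expS y) n)) ⟩
      y ⁻¹ * (y * expS y n)
        ≈⟨ *-assoc _ _ _ ⟨
      (y ⁻¹ * y) * expS y n
        ≈⟨ trans (*-congʳ (inverseˡ y y≉0)) (*-identityˡ _) ⟩
      expS y n ∎
      where open ≈-Reasoning

    Dw≋1 : D w ≋ 𝟙
    Dw≋1 = ≋-trans (⊛-congˡ (expS (- y)) deriv-w) (≋-trans (⊛-comm _ (expS y)) expS-neg-inverse)

    A : ℕ → PS
    A s k = a 0 (k +ℕ s)

    -- B s and R s are the two sides of (2).
    G Q R B : ℕ → PS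
    G s   = powS w s ⊛ compose (A s) u
    Q s   = D^ s (G s)
    R s   = scale (fact⁻¹ s) (expS (ofℕ s * y) ⊛ Q s)
    B s n = a n s * fact⁻¹ n

    G-shift : ∀ s → G s ≋ ((const x ⊛ G (suc s)) ⊕ (const (a 0 s) ⊛ powS w s))
    G-shift s = begin
      P ⊛ compose (A s) u
        ≈⟨ ⊛-congˡ P (compose-shift (A s) u-zeroth) ⟩
      P ⊛ (const (a 0 s) ⊕ (u ⊛ compose (tailS (A s)) u))
        ≈⟨ ⊛-congˡ P (⊕-congˡ (const (a 0 s)) (⊛-cong u≋x⊛w (compose-cong u tail-A))) ⟩
      P ⊛ (const (a 0 s) ⊕ ((const x ⊛ w) ⊛ compose (A (suc s)) u))
        ≈⟨ PS.solve 5 (λ p c x′ w′ f → p PS.:* (c PS.:+ (x′ PS.:* w′) PS.:* f)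
                                PS.:= x′ PS.:* ((w′ PS.:* p) PS.:* f) PS.:+ c PS.:* p)
             ≋-refl P (const (a 0 s)) (const x) w (compose (A (suc s)) u) ⟩
      (const x ⊛ G (suc s)) ⊕ (const (a 0 s) ⊛ P) ∎
      where
      open ≋-Reasoning
      P : PS
      P = powS w s
      tail-A : tailS (A s) ≋ A (suc s)
      tail-A k = reflexive (≡.cong (a 0) (≡.sym (ℕ.+-suc k s)))

    D^-G : ∀ s → D^ (suc s) (G s) ≋ (const x ⊛ Q (suc s))
    D^-G s = begin
      D^ (suc s) (G s)
        ≈⟨ D^-cong (suc s) (G-shift s) ⟩
      D^ (suc s) ((const x ⊛ G (suc s)) ⊕ (const (a 0 s) ⊛ powS w s))
        ≈⟨ D^-⊕ (suc s) _ _ ⟩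
      D^ (suc s) (const x ⊛ G (suc s)) ⊕ D^ (suc s) (const (a 0 s) ⊛ powS w s)
        ≈⟨ ⊕-cong (D^-const-⊛ (suc s) x (G (suc s))) (D^-const-⊛ (suc s) (a 0 s) (powS w s)) ⟩
      (const x ⊛ Q (suc s)) ⊕ (const (a 0 s) ⊛ D^ (suc s) (powS w s))
        ≈⟨ ⊕-congˡ (const x ⊛ Q (suc s))
             (≋-trans (⊛-congˡ (const (a 0 s)) (D^-powS-vanish Dw≋1 w-zeroth s)) (⊛-zeroʳ _)) ⟩
      (const x ⊛ Q (suc s)) ⊕ 𝟘
        ≈⟨ PS.solve 1 (λ q → q PS.:+ PS.con 0 PS.:= q) ≋-refl (const x ⊛ Q (suc s)) ⟩
      const x ⊛ Q (suc s) ∎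
      where open ≋-Reasoning

    deriv-Q : ∀ s → deriv (Q s) ≋ (expS y ⊛ (const x ⊛ Q (suc s)))
    deriv-Q s = ≋-trans (deriv-via-D expS-neg-inverse (Q s)) (⊛-congˡ (expS y) (D^-G s))

    R-as-⊛ : ∀ s → R s ≋ (const (fact⁻¹ s) ⊛ (expS (ofℕ s * y) ⊛ Q s))
    R-as-⊛ s = ≋-sym (const-⊛ (fact⁻¹ s) _)

    expS-ofℕ-suc : ∀ s → (expS (ofℕ s * y) ⊛ expS y) ≋ expS (ofℕ (suc s) * y)
    expS-ofℕ-suc s = ≋-trans (expS-+ _ y) (expS-cong (begin
      ofℕ s * y + y         ≈⟨ +-comm _ y ⟩
      y + ofℕ s * y         ≈⟨ +-congʳ (*-identityˡ y) ⟨
      1# * y + ofℕ s * y    ≈⟨ distribʳ y 1# (ofℕ s) ⟨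
      (1# + ofℕ s) * y      ∎))
      where open ≈-Reasoning

    x*fact⁻¹ : ∀ s → (const x ⊛ const (fact⁻¹ s)) ≋ (const (x * ofℕ (suc s)) ⊛ const (fact⁻¹ (suc s)))
    x*fact⁻¹ s = ≋-trans (≋-sym (const-* _ _)) (≋-trans (const-cong scalar) (const-* _ _))
      where
      scalar : x * fact⁻¹ s ≈ (x * ofℕ (suc s)) * fact⁻¹ (suc s)
      scalar = trans (*-congˡ (sym (fact⁻¹-suc s))) (sym (*-assoc _ _ _))

    deriv-R : ∀ s → deriv (R s) ≋ ((const (x * ofℕ (suc s)) ⊛ R (suc s)) ⊕ (const (ofℕ s * y) ⊛ R s))
    deriv-R s = begin
      deriv (R s)
        ≈⟨ deriv-cong (R-as-⊛ s) ⟩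
      deriv (I ⊛ (E ⊛ Q s))
        ≈⟨ deriv-const-⊛ (fact⁻¹ s) (E ⊛ Q s) ⟩
      I ⊛ deriv (E ⊛ Q s)
        ≈⟨ ⊛-congˡ I (deriv-⊛ E (Q s)) ⟩
      I ⊛ ((deriv E ⊛ Q s) ⊕ (E ⊛ deriv (Q s)))
        ≈⟨ ⊛-congˡ I (⊕-cong (⊛-congʳ (Q s) (deriv-expS _)) (⊛-congˡ E (deriv-Q s))) ⟩
      I ⊛ (((C ⊛ E) ⊛ Q s) ⊕ (E ⊛ (expS y ⊛ (const x ⊛ Q (suc s)))))
        ≈⟨ PS.solve 7 (λ i c e q e₁ x′ q′ →
              i PS.:* ((c PS.:* e) PS.:* q PS.:+ e PS.:* (e₁ PS.:* (x′ PS.:* q′)))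
              PS.:= (x′ PS.:* i) PS.:* ((e PS.:* e₁) PS.:* q′) PS.:+ c PS.:* (i PS.:* (e PS.:* q)))
            ≋-refl I C E (Q s) (expS y) (const x) (Q (suc s)) ⟩
      ((const x ⊛ I) ⊛ ((E ⊛ expS y) ⊛ Q (suc s))) ⊕ (C ⊛ (I ⊛ (E ⊛ Q s)))
        ≈⟨ ⊕-cong (⊛-cong (x*fact⁻¹ s) (⊛-congʳ (Q (suc s)) (expS-ofℕ-suc s))) (⊛-congˡ C (≋-sym (R-as-⊛ s))) ⟩
      ((const (x * ofℕ (suc s)) ⊛ const (fact⁻¹ (suc s))) ⊛ (expS (ofℕ (suc s) * y) ⊛ Q (suc s))) ⊕ (C ⊛ R s)
        ≈⟨ ⊕-cong (≋-trans (⊛-assoc _ _ (expS (ofℕ (suc s) * y) ⊛ Q (suc s)))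
                           (⊛-congˡ (const (x * ofℕ (suc s))) (≋-sym (R-as-⊛ (suc s))))) ≋-refl ⟩
      (const (x * ofℕ (suc s)) ⊛ R (suc s)) ⊕ (C ⊛ R s) ∎
      where
      open ≋-Reasoning
      I C E : PS
      I = const (fact⁻¹ s)
      C = const (ofℕ s * y)
      E = expS (ofℕ s * y)

    deriv-B : ∀ s → deriv (B s) ≋ ((const (x * ofℕ (suc s)) ⊛ B (suc s)) ⊕ (const (ofℕ s * y) ⊛ B s))
    deriv-B s n = begin
      ofℕ (suc n) * (a (suc n) s * fact⁻¹ (suc n))
        ≈⟨ *-congˡ (*-congʳ (rec n s)) ⟩
      ofℕ (suc n) * ((x * (ofℕ (suc s) * a n (suc s)) + y * (ofℕ s * a n s)) * fact⁻¹ (suc n))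
        ≈⟨ S.solve 8 (λ k x′ p q y′ r t i →
             k S.:* ((x′ S.:* (p S.:* q) S.:+ y′ S.:* (r S.:* t)) S.:* i)
             S.:= (x′ S.:* p) S.:* (q S.:* (k S.:* i)) S.:+ (r S.:* y′) S.:* (t S.:* (k S.:* i)))
           refl (ofℕ (suc n)) x (ofℕ (suc s)) (a n (suc s)) y (ofℕ s) (a n s) (fact⁻¹ (suc n)) ⟩
        (x * ofℕ (suc s)) * (a n (suc s) * (ofℕ (suc n) * fact⁻¹ (suc n)))
      + (ofℕ s * y) * (a n s * (ofℕ (suc n) * fact⁻¹ (suc n)))
        ≈⟨ +-cong (*-congˡ (*-congˡ (fact⁻¹-suc n))) (*-congˡ (*-congˡ (fact⁻¹-suc n))) ⟩
      (x * ofℕ (suc s)) * B (suc s) n + (ofℕ s * y) * B s n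
        ≈⟨ +-cong (const-⊛ _ (B (suc s)) n) (const-⊛ _ (B s) n) ⟨
      ((const (x * ofℕ (suc s)) ⊛ B (suc s)) ⊕ (const (ofℕ s * y) ⊛ B s)) n ∎
      where open ≈-Reasoning

    B-zeroth : ∀ s → B s 0 ≈ a 0 s
    B-zeroth s = trans (*-congˡ fact⁻¹-zero) (*-identityʳ _)

    R-zeroth : ∀ s → R s 0 ≈ a 0 s
    R-zeroth s = begin
      fact⁻¹ s * (expS (ofℕ s * y) 0 * Q s 0)
        ≈⟨ *-congˡ (*-cong (expS-zeroth (ofℕ s * y)) (D^-powS-⊛-zeroth Dw≋1 w-zeroth s (compose (A s) u))) ⟩
      fact⁻¹ s * (1# * (ofℕ (fact s) * (a 0 s * 1#)))
        ≈⟨ S.solve 3 (λ i f p → i S.:* (S.con 1 S.:* (f S.:* (p S.:* S.con 1))) S.:= (i S.:* f) S.:* p)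
                     refl (fact⁻¹ s) (ofℕ (fact s)) (a 0 s) ⟩
      (fact⁻¹ s * ofℕ (fact s)) * a 0 s
        ≈⟨ trans (*-congʳ (fact⁻¹-*-fact s)) (*-identityˡ _) ⟩
      a 0 s ∎
      where open ≈-Reasoning

    B≋R : ∀ s → B s ≋ R s
    B≋R = linear-system-unique (λ s → x * ofℕ (suc s)) (λ s → ofℕ s * y) deriv-B deriv-R
      (λ s → trans (B-zeroth s) (sym (R-zeroth s)))

mainTheorem1 : {c ℓ : Level} (F : CharZeroField c ℓ) →
    let open CharZeroField F hiding (_×_)
        open PowerSeries F
    in (x y : Carrier) → ¬ (x ≈ 0#) → ¬ (y ≈ 0#) →
       (a : ℕ → ℕ → Carrier) →
       (∀ n m → a (suc n) m ≈ (x * (ofℕ (suc m) * a n (suc m)) + y * (ofℕ m * a n m))) →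
       ((∀ n m → a n m ≈ (ofℕ (fact m) ⁻¹) * sumTo n (λ k → ofℕ (rStirling m (n +ℕ m) (k +ℕ m)) * ofℕ (fact (k +ℕ m)) * (y ^ (n ∸ k)) * (x ^ k) * a 0 (m +ℕ k)))
        × (∀ s → (λ n → a n s * (ofℕ (fact n) ⁻¹))
                 ≋ scale (ofℕ (fact s) ⁻¹)
                     (expS (ofℕ s * y)
                      ⊛ iterate s (λ f → expS (- y) ⊛ deriv f)
                          (powS (scale (y ⁻¹) (expS y ⊖ const 1#)) s
                           ⊛ compose (λ k → a 0 (k +ℕ s)) (scale (x * (y ⁻¹)) (expS y ⊖ const 1#))))))
mainTheorem1 F x y _ y≉0 a rec = -- the argument never divides by x
  ExplicitFormula.explicit-formula F x y a rec , GeneratingFunction.B≋R F x y y≉0 a rec
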